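{- Let $b\ge 2$ be an integer. The sequence $\gamma_k:=\frac{Z_b(b^k)}{b^k}$, $k\ge1$, is strictly increasing. Consequently $\frac{Z_b(b^k)}{b^k}<\lim_{m\to\infty}\frac{Z_b(m)}{m}$ for every $k>0$.
   Context: $Z_b(m)$ is the number of trailing zeroes in the base-$b$ expansion of $m!$, i.e. the largest $e\ge0$ with $b^e\mid m!$. -}

module Defs where

open import Data.Nat using (ℕ; zero; suc; _^_; _≤_; _!)
open import Data.Nat.Divisibility using (_∣_)
open import Data.Integer using (+_)
open import Data.Rational using (ℚ; 0ℚ; _/_; _-_; ∣_∣; _<_)
open import Data.Product using (_×_; Σ)

IsTrailingZeros : (b m e : ℕ) → Set
IsTrailingZeros b m e = (b ^ e ∣ m !) × (∀ e′ → b ^ e′ ∣ m ! → e′ ≤ e)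

-- the rational number Z(m)/m  (m ≥ 1; the value at m = 0 is irrelevant and set to 0)
ratio : (Z : ℕ → ℕ) → ℕ → ℚ
ratio Z zero = 0ℚ
ratio Z (suc n) = (+ Z (suc n)) / suc n

ConvergesTo : (ℕ → ℚ) → ℚ → Set
ConvergesTo f L = ∀ (ε : ℚ) → 0ℚ < ε → Σ ℕ λ N → ∀ m → N ≤ m → ∣ f m - L ∣ < ε

module Submission where

-- Monotonicity: b·(n!)^b divides (b·n)!, so Z(b·n) ≥ b·Z(n) + 1, whence
-- Z(b^(k+1))/b^(k+1) > Z(b^k)/b^k.
--
-- Limit: for a prime p = 1 + p′ the splitting m! = p^q · q! · ρ (q = ⌊m/p⌋, p ∤ ρ)
-- gives Legendre-type bounds on the exponent of p in m!: it is below m/p′ and at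
-- least m/p′ − log₂ m.  By strong induction along the factorisation of b, one prime
-- power p^e ∣ b, of weight M = e·p′, governs b: b^j ∣ m! as soon as
-- j·M + b·log₂ m ≤ m.  Hence m − (M + b·log₂ m) < Z(m)·M < m, so Z(m)/m stays below
-- 1/M and converges to it.

open import Defs
open import Data.Nat using (ℕ; suc; _^_; _≤_)

module FactorialDivisibility where
  open import Data.Nat
  open import Data.Nat.Properties
  open import Data.Nat.Divisibility
  open import Data.Nat.Primality
  open import Data.Nat.Primality.Factorisation using (PrimeFactorisation; factorise)
  open import Data.Nat.ListAction using (product)
  open import Data.List.Base using ([]; _∷_)
  open import Data.List.Relation.Unary.All using (_∷_)
  open import Data.Nat.Induction using (<-rec)
  open import Data.Nat.Combinatorics using (k![n∸k]!∣n!)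
  open import Data.Nat.Tactic.RingSolver using (solve-∀)
  open import Data.Product using (Σ; _×_; _,_; proj₁; proj₂)
  open import Data.Sum using (_⊎_; inj₁; inj₂)
  open import Relation.Nullary using (Dec; yes; no; contradiction)
  open import Relation.Binary.PropositionalEquality

  prime≥2 : ∀ {p} → Prime p → 2 ≤ p
  prime≥2 {p} pp = nonTrivial⇒n>1 p {{prime⇒nonTrivial pp}}

  prime∤1 : ∀ {p} → Prime p → p ∤ 1
  prime∤1 pp p∣1 = <⇒≱ (prime≥2 pp) (∣⇒≤ p∣1)

  prime∤^ : ∀ {p c} → Prime p → p ∤ c → ∀ j → p ∤ c ^ j
  prime∤^ pp p∤c zero = prime∤1 pp
  prime∤^ {c = c} pp p∤c (suc j) p∣c^[1+j] with euclidsLemma c (c ^ j) pp p∣c^[1+j]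
  ... | inj₁ p∣c   = p∤c p∣c
  ... | inj₂ p∣c^j = prime∤^ pp p∤c j p∣c^j

  prime^-cancelʳ : ∀ {p r} → Prime p → p ∤ r → ∀ k x → p ^ k ∣ x * r → p ^ k ∣ x
  prime^-cancelʳ pp p∤r zero x _ = 1∣ x
  prime^-cancelʳ {p} {r} pp p∤r (suc k) x p^[1+k]∣xr
    with euclidsLemma x r pp (∣-trans (m∣m*n (p ^ k)) p^[1+k]∣xr)
  ... | inj₂ p∣r = contradiction p∣r p∤r
  ... | inj₁ (divides y refl) = subst (p * p ^ k ∣_) (*-comm p y) (*-monoʳ-∣ p p^k∣y)
    where
    reassoc : ∀ y p r → y * p * r ≡ p * (y * r)
    reassoc = solve-∀
    p^k∣y : p ^ k ∣ y
    p^k∣y = prime^-cancelʳ pp p∤r k y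
              (*-cancelˡ-∣ p {{prime⇒nonZero pp}} (subst (p * p ^ k ∣_) (reassoc y p r) p^[1+k]∣xr))

  prime^-*-∣ : ∀ {p c y} → Prime p → p ∤ c → ∀ i j → p ^ i ∣ y → c ^ j ∣ y → p ^ i * c ^ j ∣ y
  prime^-*-∣ pp p∤c i j p^i∣y (divides u refl) =
    *-monoˡ-∣ _ (prime^-cancelʳ pp (prime∤^ pp p∤c j) i u p^i∣y)

  ^-monoʳ-∣ : ∀ p {i j} → i ≤ j → p ^ i ∣ p ^ j
  ^-monoʳ-∣ p {i} {j} i≤j = subst (p ^ i ∣_) p^i*p^[j∸i]≡p^j (m∣m*n (p ^ (j ∸ i)))
    where
    p^i*p^[j∸i]≡p^j : p ^ i * p ^ (j ∸ i) ≡ p ^ j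
    p^i*p^[j∸i]≡p^j = trans (sym (^-distribˡ-+-* p i (j ∸ i))) (cong (p ^_) (m+[n∸m]≡n i≤j))

  ^-distrib-* : ∀ a c j → (a * c) ^ j ≡ a ^ j * c ^ j
  ^-distrib-* a c zero = refl
  ^-distrib-* a c (suc j) = trans (cong ((a * c) *_) (^-distrib-* a c j)) (interchange a c (a ^ j) (c ^ j))
    where
    interchange : ∀ a c x y → a * c * (x * y) ≡ a * x * (c * y)
    interchange = solve-∀

  ^-monoˡ-∣ : ∀ {a c} j → a ∣ c → a ^ j ∣ c ^ j
  ^-monoˡ-∣ zero    a∣c = ∣-refl
  ^-monoˡ-∣ (suc j) a∣c = *-pres-∣ a∣c (^-monoˡ-∣ j a∣c)

  -- Splitting m! at a prime p: the multiples p, 2p, …, qp of p among 1, …, m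
  -- contribute p^q · q!, and every other factor is prime to p; here q = ⌊m/p⌋.
  record FactorialSplit (p m : ℕ) : Set where
    field
      q ρ        : ℕ
      split      : m ! ≡ p ^ q * q ! * ρ
      p∤ρ        : p ∤ ρ
      q*p≤m      : q * p ≤ m
      m<[1+q]*p  : m < suc q * p

  factorialSplit : ∀ {p} → Prime p → ∀ m → FactorialSplit p m
  factorialSplit {p} pp zero = record
    { q = 0 ; ρ = 1 ; split = refl ; p∤ρ = prime∤1 pp ; q*p≤m = z≤n
    ; m<[1+q]*p = subst (0 <_) (sym (+-identityʳ p)) (<-trans z<s (prime≥2 pp)) }
  factorialSplit {p} pp (suc m) with factorialSplit pp m
  ... | record { q = q ; ρ = ρ ; split = split ; p∤ρ = p∤ρ ; q*p≤m = q*p≤m ; m<[1+q]*p = m<[1+q]*p }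
    with suc m ≟ suc q * p
  ... | yes 1+m≡[1+q]*p = record
    { q = suc q ; ρ = ρ ; split = split′ ; p∤ρ = p∤ρ ; q*p≤m = ≤-reflexive (sym 1+m≡[1+q]*p)
    ; m<[1+q]*p = subst (_< p + suc q * p) (sym 1+m≡[1+q]*p) (m<n+m _ (<-trans z<s (prime≥2 pp))) }
    where
    regroup : ∀ q′ p P F ρ → (q′ * p) * (P * F * ρ) ≡ (p * P) * (q′ * F) * ρ
    regroup = solve-∀
    split′ : suc m ! ≡ p ^ suc q * suc q ! * ρ
    split′ = trans (cong₂ _*_ 1+m≡[1+q]*p split) (regroup (suc q) p (p ^ q) (q !) ρ)
  ... | no 1+m≢[1+q]*p = record
    { q = q ; ρ = suc m * ρ ; split = trans (cong (suc m *_) split) (regroup (suc m) (p ^ q) (q !) ρ)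
    ; p∤ρ = p∤[1+m]ρ
    ; q*p≤m = m≤n⇒m≤1+n q*p≤m ; m<[1+q]*p = 1+m<[1+q]*p }
    where
    regroup : ∀ n P F ρ → n * (P * F * ρ) ≡ P * F * (n * ρ)
    regroup = solve-∀
    1+m<[1+q]*p : suc m < suc q * p
    1+m<[1+q]*p = ≤∧≢⇒< m<[1+q]*p 1+m≢[1+q]*p
    -- 1 + m lies strictly between the consecutive multiples q·p and (1+q)·p
    p∤1+m : p ∤ suc m
    p∤1+m (divides k 1+m≡k*p) = <⇒≱ q<k (≤-pred k<1+q)
      where
      q<k : q < k
      q<k = *-cancelʳ-< p q k (subst (q * p <_) 1+m≡k*p (s≤s q*p≤m))
      k<1+q : k < suc q
      k<1+q = *-cancelʳ-< p k (suc q) (subst (_< suc q * p) 1+m≡k*p 1+m<[1+q]*p)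
    p∤[1+m]ρ : p ∤ suc m * ρ
    p∤[1+m]ρ p∣[1+m]ρ with euclidsLemma (suc m) ρ pp p∣[1+m]ρ
    ... | inj₁ p∣1+m = p∤1+m p∣1+m
    ... | inj₂ p∣ρ   = p∤ρ p∣ρ

  ≤-or-exceeds : ∀ j q → j ≤ q ⊎ Σ ℕ (λ t → 1 ≤ t × j ≡ q + t)
  ≤-or-exceeds j q with j ≤? q
  ... | yes j≤q = inj₁ j≤q
  ... | no j≰q  = inj₂ (j ∸ q , m<n⇒0<n∸m q<j , sym (m+[n∸m]≡n (<⇒≤ q<j)))
    where q<j = ≰⇒> j≰q

  -- If (q + t + (1+k))·p′ ≤ m < (1+q)·(1+p′), then (t + k)·p′ ≤ q: the exponent left
  -- over after the q multiples of p in m! is again within Legendre's range for q!.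
  exceedance : ∀ q t k p′ m → (q + t + suc k) * p′ ≤ m → m < suc q * suc p′ → (t + k) * p′ ≤ q
  exceedance q t k p′ m le lt = ≤-pred (+-cancelˡ-< (q * p′ + p′) ((t + k) * p′) (suc q) (begin-strict
      q * p′ + p′ + (t + k) * p′  ≡⟨ expandˡ q t k p′ ⟩
      (q + t + suc k) * p′        ≤⟨ le ⟩
      m                           <⟨ lt ⟩
      suc q * suc p′              ≡⟨ expandʳ q p′ ⟩
      q * p′ + p′ + suc q         ∎))
    where
    open ≤-Reasoning
    expandˡ : ∀ q t k p′ → q * p′ + p′ + (t + k) * p′ ≡ (q + t + suc k) * p′
    expandˡ = solve-∀
    expandʳ : ∀ q p′ → suc q * suc p′ ≡ q * p′ + p′ + suc q
    expandʳ = solve-∀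

  module Legendre {p′} (pp : Prime (suc p′)) where
    p : ℕ
    p = suc p′

    1≤p′ : 1 ≤ p′
    1≤p′ = ≤-pred (prime≥2 pp)

    1≤n : ∀ {t n} → 1 ≤ t → p ^ t ∣ n ! → 1 ≤ n
    1≤n {n = zero} (s≤s _) p^t∣1 = contradiction (∣-trans (m∣m*n _) p^t∣1) (prime∤1 pp)
    1≤n {n = suc n} _ _ = s≤s z≤n

    module Split (m : ℕ) where
      open FactorialSplit (factorialSplit pp m) public

      within : ∀ {j} → j ≤ q → p ^ j ∣ m !
      within j≤q = ∣-trans (^-monoʳ-∣ p j≤q) (subst (p ^ q ∣_) (sym split) (∣m⇒∣m*n ρ (m∣m*n (q !))))

      shift-down : ∀ t → p ^ (q + t) ∣ m ! → p ^ t ∣ q !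
      shift-down t p^[q+t]∣m! =
        prime^-cancelʳ pp p∤ρ t (q !) (*-cancelˡ-∣ (p ^ q) {{m^n≢0 p q}} p^q*p^t∣p^q*[q!*ρ])
        where
        p^q*p^t∣p^q*[q!*ρ] : p ^ q * p ^ t ∣ p ^ q * (q ! * ρ)
        p^q*p^t∣p^q*[q!*ρ] =
          subst₂ _∣_ (^-distribˡ-+-* p q t) (trans split (*-assoc (p ^ q) (q !) ρ)) p^[q+t]∣m!

      shift-up : ∀ t → p ^ t ∣ q ! → p ^ (q + t) ∣ m !
      shift-up t p^t∣q! =
        subst₂ _∣_ (sym (^-distribˡ-+-* p q t)) (sym split) (∣m⇒∣m*n ρ (*-monoʳ-∣ (p ^ q) p^t∣q!))

      q*p′<m : 1 ≤ m → q * p′ < m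
      q*p′<m 1≤m with q | q*p≤m
      ... | zero  | _ = 1≤m
      ... | suc q | le = <-≤-trans (*-monoʳ-< (suc q) (n<1+n p′)) le

      q<m : 1 ≤ q → q < m
      q<m 1≤q = <-≤-trans (m<m*n q p {{>-nonZero 1≤q}} (prime≥2 pp)) q*p≤m

    valuation-upper : ∀ m j → 1 ≤ m → p ^ j ∣ m ! → j * p′ < m
    valuation-upper = <-rec UpperBound bound
      where
      UpperBound : ℕ → Set
      UpperBound m = ∀ j → 1 ≤ m → p ^ j ∣ m ! → j * p′ < m
      bound : ∀ m → (∀ {n} → n < m → UpperBound n) → UpperBound m
      bound m rec j 1≤m p^j∣m! with ≤-or-exceeds j (Split.q m)
      ... | inj₁ j≤q = ≤-<-trans (*-monoˡ-≤ p′ j≤q) (q*p′<m 1≤m)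
        where open Split m
      ... | inj₂ (t , 1≤t , refl) = begin-strict
          (q + t) * p′     ≡⟨ *-distribʳ-+ p′ q t ⟩
          q * p′ + t * p′  <⟨ +-monoʳ-< (q * p′) (rec (q<m 1≤q) t 1≤q p^t∣q!) ⟩
          q * p′ + q       ≡⟨ +-comm (q * p′) q ⟩
          q + q * p′       ≡⟨ *-suc q p′ ⟨
          q * p            ≤⟨ q*p≤m ⟩
          m                ∎
        where
        open Split m
        open ≤-Reasoning
        p^t∣q! = shift-down t p^j∣m!
        1≤q = 1≤n 1≤t p^t∣q!

    valuation-lower : ∀ k m j → m < 2 ^ k → (j + k) * p′ ≤ m → p ^ j ∣ m !
    valuation-lower k m j m<2^k j+k≤ with ≤-or-exceeds j (Split.q m)
    ... | inj₁ j≤q = within j≤q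
      where open Split m
    ... | inj₂ (t , 1≤t , refl) = shift-up t (descend k m<2^k j+k≤)
      where
      open Split m
      descend : ∀ k → m < 2 ^ k → (q + t + k) * p′ ≤ m → p ^ t ∣ q !
      descend zero m<1 q+t+0≤ = contradiction (≤-trans 1≤t*p′ (≤-trans t*p′≤ q+t+0≤)) (<⇒≱ m<1)
        where
        1≤t*p′ : 1 ≤ t * p′
        1≤t*p′ = *-mono-≤ 1≤t 1≤p′
        t*p′≤ : t * p′ ≤ (q + t + 0) * p′
        t*p′≤ = *-monoˡ-≤ p′ (≤-trans (m≤n+m t q) (m≤m+n (q + t) 0))
      descend (suc k) m<2^[1+k] q+t+[1+k]≤ =
        valuation-lower k q t q<2^k (exceedance q t k p′ m q+t+[1+k]≤ m<[1+q]*p)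
        where
        open ≤-Reasoning
        q<2^k : q < 2 ^ k
        q<2^k = *-cancelʳ-< 2 q (2 ^ k) (begin-strict
          q * 2      ≤⟨ *-monoʳ-≤ q (prime≥2 pp) ⟩
          q * p      ≤⟨ q*p≤m ⟩
          m          <⟨ m<2^[1+k] ⟩
          2 * 2 ^ k  ≡⟨ *-comm 2 (2 ^ k) ⟩
          2 ^ k * 2  ∎)

  primeDivisor : ∀ n → 2 ≤ n → Σ ℕ λ p → Prime p × p ∣ n
  primeDivisor n 2≤n = firstFactor (factorise n {{>-nonZero (<-trans z<s 2≤n)}})
    where
    firstFactor : PrimeFactorisation n → Σ ℕ λ p → Prime p × p ∣ n
    firstFactor record { factors = [] ; isFactorisation = n≡1 } = contradiction (sym n≡1) (<⇒≢ 2≤n)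
    firstFactor record { factors = p ∷ ps ; isFactorisation = n≡p*Πps ; factorsPrime = pp ∷ _ } =
      p , pp , subst (p ∣_) (sym n≡p*Πps) (m∣m*n (product ps))

  primePart : ∀ {p} → Prime p → ∀ n → 1 ≤ n → Σ ℕ λ e → Σ ℕ λ c → n ≡ p ^ e * c × p ∤ c
  primePart {p} pp = <-rec PrimePart part
    where
    PrimePart : ℕ → Set
    PrimePart n = 1 ≤ n → Σ ℕ λ e → Σ ℕ λ c → n ≡ p ^ e * c × p ∤ c
    regroup : ∀ x c p → x * c * p ≡ p * x * c
    regroup = solve-∀
    part : ∀ n → (∀ {m} → m < n → PrimePart m) → PrimePart n
    part n rec 1≤n with p ∣? n
    ... | no p∤n = 0 , n , sym (+-identityʳ n) , p∤n
    ... | yes (divides zero refl) = contradiction 1≤n λ ()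
    ... | yes (divides k@(suc _) refl) with rec (m<m*n k p (prime≥2 pp)) (s≤s z≤n)
    ...   | e , c , k≡p^e*c , p∤c = suc e , c , trans (cong (_* p) k≡p^e*c) (regroup (p ^ e) c p) , p∤c

  -- n^j divides m! as soon as j·w plus the logarithmic error s·k is at most m, where
  -- m < 2^k; w is the weight of the bound and s its slack.
  FactorialBound : (s n w : ℕ) → Set
  FactorialBound s n w = ∀ j m k → m < 2 ^ k → j * w + s * k ≤ m → n ^ j ∣ m !

  factorialBound-weaken : ∀ {s s′ n w w′} → s ≤ s′ → w ≤ w′ → FactorialBound s n w → FactorialBound s′ n w′
  factorialBound-weaken s≤s′ w≤w′ bound j m k m<2^k le =
    bound j m k m<2^k (≤-trans (+-mono-≤ (*-monoʳ-≤ j w≤w′) (*-monoˡ-≤ k s≤s′)) le)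

  primePower-bound : ∀ {p′} → Prime (suc p′) → ∀ e → FactorialBound p′ (suc p′ ^ e) (e * p′)
  primePower-bound {p′} pp e j m k m<2^k le =
    subst (_∣ m !) (sym (^-*-assoc (suc p′) e j))
      (Legendre.valuation-lower pp k m (e * j) m<2^k (≤-trans (≤-reflexive (regroup e j k p′)) le))
    where
    regroup : ∀ e j k p′ → (e * j + k) * p′ ≡ j * (e * p′) + p′ * k
    regroup = solve-∀

  factorialBound-* : ∀ {s p e c w} → Prime p → p ∤ c →
    FactorialBound s (p ^ e) w → FactorialBound s c w → FactorialBound s (p ^ e * c) w
  factorialBound-* {p = p} {e} {c} pp p∤c bound-p^e bound-c j m k m<2^k le =
    subst (_∣ m !) (sym (trans (^-distrib-* (p ^ e) c j) (cong (_* c ^ j) (^-*-assoc p e j))))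
      (prime^-*-∣ pp p∤c (e * j) j
        (subst (_∣ m !) (^-*-assoc p e j) (bound-p^e j m k m<2^k le))
        (bound-c j m k m<2^k le))

  -- A prime power divisor p^e of n (e ≥ 1) whose weight e·(p−1) governs the growth of
  -- the exponent of n in m!: n^j ∣ m! once j·e·(p−1) + n·log₂ m ≤ m.
  record GoverningPrimePower (n : ℕ) : Set where
    field
      p′ e    : ℕ
      isPrime : Prime (suc p′)
      1≤e     : 1 ≤ e
      p^e∣n   : suc p′ ^ e ∣ n
      bound   : FactorialBound n n (e * p′)

    weight : ℕ
    weight = e * p′

  -- Induction step: if n = p^e·c with p ∤ c and e ≥ 1, the heavier of p^e and the
  -- governing prime power of c (when c ≥ 2) governs n.
  governing-step : ∀ {n p′ e c} → 1 ≤ n → Prime (suc p′) → n ≡ suc p′ ^ e * c → suc p′ ∤ c → 1 ≤ e →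
    (2 ≤ c → GoverningPrimePower c) → GoverningPrimePower n
  governing-step {n} {p′} {e} {c} 1≤n pp n≡p^e*c p∤c 1≤e governing-c = choose (m≤n⇒m<n∨m≡n 1≤c)
    where
    instance
      n≢0 : NonZero n
      n≢0 = >-nonZero 1≤n
    p = suc p′
    1≤c : 1 ≤ c
    1≤c = n≢0⇒n>0 λ c≡0 →
      contradiction (trans n≡p^e*c (trans (cong (p ^ e *_) c≡0) (*-zeroʳ (p ^ e)))) (>⇒≢ 1≤n)
    c∣n : c ∣ n
    c∣n = subst (c ∣_) (sym n≡p^e*c) (n∣m*n (p ^ e))
    p^e∣n : p ^ e ∣ n
    p^e∣n = subst (p ^ e ∣_) (sym n≡p^e*c) (m∣m*n c)
    p′≤n : p′ ≤ n
    p′≤n = ≤-trans (n≤1+n p′) (∣⇒≤ (∣-trans (subst (_∣ p ^ e) (*-identityʳ p) (^-monoʳ-∣ p 1≤e)) p^e∣n))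
    bound-at : ∀ {w} → e * p′ ≤ w → FactorialBound n c w → FactorialBound n n w
    bound-at {w} e*p′≤w bound-c = subst (λ x → FactorialBound n x w) (sym n≡p^e*c)
      (factorialBound-* {s = n} {e = e} pp p∤c
        (factorialBound-weaken p′≤n e*p′≤w (primePower-bound pp e)) bound-c)
    p^e-governs : FactorialBound n c (e * p′) → GoverningPrimePower n
    p^e-governs bound-c = record
      { p′ = p′ ; e = e ; isPrime = pp ; 1≤e = 1≤e ; p^e∣n = p^e∣n ; bound = bound-at ≤-refl bound-c }
    heavier : GoverningPrimePower c → GoverningPrimePower n
    heavier G = byWeight (G.weight ≤? e * p′)
      where
      module G = GoverningPrimePower G
      byWeight : Dec (G.weight ≤ e * p′) → GoverningPrimePower n
      byWeight (yes w≤e*p′) = p^e-governs (factorialBound-weaken (∣⇒≤ c∣n) w≤e*p′ G.bound)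
      byWeight (no w≰e*p′) = record
        { p′ = G.p′ ; e = G.e ; isPrime = G.isPrime ; 1≤e = G.1≤e ; p^e∣n = ∣-trans G.p^e∣n c∣n
        ; bound = bound-at (<⇒≤ (≰⇒> w≰e*p′)) (factorialBound-weaken (∣⇒≤ c∣n) ≤-refl G.bound) }
    choose : 1 < c ⊎ 1 ≡ c → GoverningPrimePower n
    choose (inj₁ 2≤c) = heavier (governing-c 2≤c)
    choose (inj₂ refl) = p^e-governs λ j m _ _ _ → subst (_∣ m !) (sym (^-zeroˡ j)) (1∣ (m !))

  governing : ∀ n → 2 ≤ n → GoverningPrimePower n
  governing = <-rec (λ n → 2 ≤ n → GoverningPrimePower n) govern
    where
    govern : ∀ n → (∀ {c} → c < n → 2 ≤ c → GoverningPrimePower c) → 2 ≤ n → GoverningPrimePower n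
    govern n rec 2≤n with primeDivisor n 2≤n
    ... | zero , pp , _ = contradiction pp ¬prime[0]
    ... | suc p′ , pp , p∣n with primePart pp n (<-trans z<s 2≤n)
    ...   | e , c , n≡p^e*c , p∤c =
      governing-step (<-trans z<s 2≤n) pp n≡p^e*c p∤c 1≤e λ 2≤c → rec (c<n 2≤c) 2≤c
      where
      p = suc p′
      1≤e : 1 ≤ e
      1≤e = n≢0⇒n>0 λ e≡0 →
        p∤c (subst (p ∣_) (trans n≡p^e*c (trans (cong (λ x → p ^ x * c) e≡0) (*-identityˡ c))) p∣n)
      c<n : 2 ≤ c → c < n
      c<n 2≤c = subst (c <_) (trans (*-comm c (p ^ e)) (sym n≡p^e*c))
        (m<m*n c (p ^ e) {{>-nonZero (<-trans z<s 2≤c)}} (<-≤-trans (prime≥2 pp) p≤p^e))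
        where
        p≤p^e : p ≤ p ^ e
        p≤p^e = subst (_≤ p ^ e) (*-identityʳ p) (^-monoʳ-≤ p 1≤e)

  factorial-+-∣ : ∀ m n → m ! * n ! ∣ (m + n) !
  factorial-+-∣ m n = subst (λ x → m ! * x ! ∣ (m + n) !) (m+n∸m≡n m n) (k![n∸k]!∣n! (m≤m+n m n))

  factorial-power-∣ : ∀ c n → (n !) ^ c ∣ (c * n) !
  factorial-power-∣ zero n = ∣-refl
  factorial-power-∣ (suc c) n = ∣-trans (*-monoʳ-∣ (n !) (factorial-power-∣ c n)) (factorial-+-∣ n (c * n))

  -- b·(n!)^b ∣ (b·n)! for b, n ≥ 1: the factor b·n of (b·n)! supplies b beyond (n!)^b,
  -- since (b·n)! = b·n · ((n−1) + (b−1)·n)!.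
  b*[n!]^b∣[b*n]! : ∀ b n .{{_ : NonZero b}} .{{_ : NonZero n}} → b * (n !) ^ b ∣ (b * n) !
  b*[n!]^b∣[b*n]! b@(suc c) n@(suc n′) =
    subst (_∣ (b * n) !) (regroup b n (n′ !) ((n !) ^ c))
      (*-monoʳ-∣ (b * n) (∣-trans (*-monoʳ-∣ (n′ !) (factorial-power-∣ c n)) (factorial-+-∣ n′ (c * n))))
    where
    regroup : ∀ b n f F → (b * n) * (f * F) ≡ b * ((n * f) * F)
    regroup = solve-∀

  n<2^n : ∀ n → n < 2 ^ n
  n<2^n zero    = z<s
  n<2^n (suc n) = +-mono-≤-< (m^n>0 2 n) (≤-trans (n<2^n n) (m≤m+n (2 ^ n) 0))

  binaryLength : ∀ m → Σ ℕ λ k → m < 2 ^ k × 2 ^ k ≤ 2 * m + 1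
  binaryLength zero = 0 , z<s , s≤s z≤n
  binaryLength (suc m) with binaryLength m
  ... | k , m<2^k , 2^k≤2m+1 with suc m ≟ 2 ^ k
  ...   | no 1+m≢2^k = k , ≤∧≢⇒< m<2^k 1+m≢2^k , ≤-trans 2^k≤2m+1 (+-monoˡ-≤ 1 (*-monoʳ-≤ 2 (n≤1+n m)))
  ...   | yes 1+m≡2^k = suc k , 1+m<2^[1+k] , ≤-trans (≤-reflexive (cong (2 *_) (sym 1+m≡2^k))) (m≤m+n _ 1)
    where
    1+m<2^[1+k] : suc m < 2 * 2 ^ k
    1+m<2^[1+k] = subst (λ x → x < 2 ^ k + (2 ^ k + 0)) (sym 1+m≡2^k)
      (m<m+n (2 ^ k) (≤-trans (m^n>0 2 k) (m≤m+n (2 ^ k) 0)))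

  linear≤exponential : ∀ c k → c * k ≤ 2 ^ k + c * c
  linear≤exponential c zero = subst (_≤ 1 + c * c) (sym (*-zeroʳ c)) z≤n
  linear≤exponential c (suc k) with c ≤? k
  ... | no c≰k = ≤-trans (*-monoʳ-≤ c (≰⇒> c≰k)) (m≤n+m (c * c) (2 ^ suc k))
  ... | yes c≤k = begin
      c * suc k                 ≡⟨ *-suc c k ⟩
      c + c * k                 ≤⟨ +-mono-≤ (≤-trans (<⇒≤ (n<2^n c)) (^-monoʳ-≤ 2 c≤k)) (linear≤exponential c k) ⟩
      2 ^ k + (2 ^ k + c * c)   ≡⟨ regroup (2 ^ k) (c * c) ⟩
      2 ^ suc k + c * c         ∎
    where
    open ≤-Reasoning
    regroup : ∀ x y → x + (x + y) ≡ 2 * x + y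
    regroup = solve-∀

  log-negligible : ∀ a c → Σ ℕ λ N → ∀ m → N ≤ m → Σ ℕ λ k → m < 2 ^ k × a + c * k ≤ m
  log-negligible a c = 4 * a + C + 1 , large
    where
    C = (4 * c) * (4 * c)
    large : ∀ m → 4 * a + C + 1 ≤ m → Σ ℕ λ k → m < 2 ^ k × a + c * k ≤ m
    large m N≤m with binaryLength m
    ... | k , m<2^k , 2^k≤2m+1 = k , m<2^k , *-cancelˡ-≤ 4 (begin
        4 * (a + c * k)          ≡⟨ expand a c k ⟩
        4 * a + 4 * c * k        ≤⟨ +-monoʳ-≤ (4 * a) (linear≤exponential (4 * c) k) ⟩
        4 * a + (2 ^ k + C)      ≤⟨ +-monoʳ-≤ (4 * a) (+-monoˡ-≤ C 2^k≤2m+1) ⟩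
        4 * a + (2 * m + 1 + C)  ≡⟨ regroup (4 * a) C m ⟩
        (4 * a + C + 1) + 2 * m  ≤⟨ +-monoˡ-≤ (2 * m) N≤m ⟩
        m + 2 * m                ≤⟨ m≤m+n (m + 2 * m) m ⟩
        m + 2 * m + m            ≡⟨ quadruple m ⟩
        4 * m                    ∎)
      where
      open ≤-Reasoning
      expand : ∀ a c k → 4 * (a + c * k) ≡ 4 * a + 4 * c * k
      expand = solve-∀
      regroup : ∀ A C m → A + (2 * m + 1 + C) ≡ (A + C + 1) + 2 * m
      regroup = solve-∀
      quadruple : ∀ m → m + 2 * m + m ≡ 4 * m
      quadruple = solve-∀

  module TrailingZeros (b : ℕ) (2≤b : 2 ≤ b) (Z : ℕ → ℕ) (isZ : ∀ m → IsTrailingZeros b m (Z m)) where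
    open GoverningPrimePower (governing b 2≤b)

    -- 1/M will be the limit of Z(m)/m.
    M : ℕ
    M = weight

    1≤M : 1 ≤ M
    1≤M = *-mono-≤ 1≤e (Legendre.1≤p′ isPrime)

    b^Z∣m! : ∀ m → b ^ Z m ∣ m !
    b^Z∣m! m = proj₁ (isZ m)

    Z-maximal : ∀ m j → b ^ j ∣ m ! → j ≤ Z m
    Z-maximal m = proj₂ (isZ m)

    -- Z(m)·M < m: since p^e ∣ b, p^(e·Z(m)) ∣ m!, and Legendre's upper bound applies.
    Z*M<m : ∀ m → 1 ≤ m → Z m * M < m
    Z*M<m m 1≤m = subst (_< m) (regroup e (Z m) p′)
      (Legendre.valuation-upper isPrime m (e * Z m) 1≤m
        (subst (_∣ m !) (^-*-assoc (suc p′) e (Z m)) (∣-trans (^-monoˡ-∣ (Z m) p^e∣n) (b^Z∣m! m))))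
      where
      regroup : ∀ e z p′ → e * z * p′ ≡ z * (e * p′)
      regroup = solve-∀

    -- m < (Z(m) + 1)·M + b·k when m < 2^k: otherwise the governing bound would give
    -- b^(Z(m)+1) ∣ m!.
    m<[1+Z]*M+b*k : ∀ m k → m < 2 ^ k → m < suc (Z m) * M + b * k
    m<[1+Z]*M+b*k m k m<2^k = ≰⇒> λ le → 1+n≰n (Z-maximal m (suc (Z m)) (bound (suc (Z m)) m k m<2^k le))

    -- Z(b·n) ≥ b·Z(n) + 1 for n ≥ 1, by b·(n!)^b ∣ (b·n)!.
    Z-grows : ∀ n .{{_ : NonZero n}} → suc (Z n * b) ≤ Z (b * n)
    Z-grows n = Z-maximal (b * n) (suc (Z n * b))
      (subst (_∣ (b * n) !) (cong (b *_) (^-*-assoc b (Z n) b))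
        (∣-trans (*-monoʳ-∣ b (^-monoˡ-∣ b (b^Z∣m! n))) (b*[n!]^b∣[b*n]! b n {{b≢0}})))
      where
      b≢0 : NonZero b
      b≢0 = >-nonZero (<-trans z<s 2≤b)

    Z-ratio-grows : ∀ n .{{_ : NonZero n}} → Z n * (b * n) < Z (b * n) * n
    Z-ratio-grows n = begin-strict
      Z n * (b * n)      ≡⟨ *-assoc (Z n) b n ⟨
      Z n * b * n        <⟨ *-monoˡ-< n (n<1+n (Z n * b)) ⟩
      suc (Z n * b) * n  ≤⟨ *-monoˡ-≤ n (Z-grows n) ⟩
      Z (b * n) * n      ∎
      where open ≤-Reasoning

    deficit-small : ∀ D .{{_ : NonZero D}} → Σ ℕ λ N → ∀ m → N ≤ m → (m ∸ Z m * M) * D < m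
    deficit-small D with log-negligible (M * D) (b * D)
    ... | N , large = N , small
      where
      small : ∀ m → N ≤ m → (m ∸ Z m * M) * D < m
      small m N≤m with large m N≤m
      ... | k , m<2^k , MD+bDk≤m = begin-strict
          (m ∸ Z m * M) * D    <⟨ *-monoˡ-< D deficit<M+b*k ⟩
          (M + b * k) * D      ≡⟨ regroup M b k D ⟩
          M * D + b * D * k    ≤⟨ MD+bDk≤m ⟩
          m                    ∎
        where
        open ≤-Reasoning
        regroup : ∀ M b k D → (M + b * k) * D ≡ M * D + b * D * k
        regroup = solve-∀
        deficit<M+b*k : m ∸ Z m * M < M + b * k
        deficit<M+b*k = m<n+o⇒m∸n<o m (Z m * M) {{>-nonZero (≤-trans 1≤M (m≤m+n M (b * k)))}}
          (subst (m <_) (trans (cong (_+ b * k) (+-comm M (Z m * M))) (+-assoc (Z m * M) M (b * k)))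
            (m<[1+Z]*M+b*k m k m<2^k))

module Fractions where
  open import Data.Nat as ℕ using (ℕ; suc; NonZero)
  import Data.Nat.Properties as ℕ
  open import Data.Nat.Coprimality using (Coprime)
  open import Data.Integer as ℤ using (+_; +[1+_])
  import Data.Integer.Properties as ℤ
  open import Data.Rational using (mkℚ; _/_; _-_; -_; ∣_∣; _<_; toℚᵘ)
  open import Data.Rational.Properties
    using (toℚᵘ-cancel-<; toℚᵘ-fromℚᵘ; toℚᵘ-homo-∣-∣; toℚᵘ-homo-+; toℚᵘ-homo‿-)
  open import Data.Rational.Unnormalised as ℚᵘ using (mkℚᵘ; _≃_; *<*)
  import Data.Rational.Unnormalised.Properties as ℚᵘ
  open import Relation.Binary.PropositionalEquality

  /≃mkℚᵘ : ∀ i x → toℚᵘ (i / suc x) ≃ mkℚᵘ i x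
  /≃mkℚᵘ i x = toℚᵘ-fromℚᵘ (mkℚᵘ i x)

  ratio≡ : ∀ Z m .{{_ : NonZero m}} → ratio Z m ≡ + Z m / m
  ratio≡ Z (suc _) = refl

  fraction-< : ∀ a c m n .{{_ : NonZero m}} .{{_ : NonZero n}} → a ℕ.* n ℕ.< c ℕ.* m → + a / m < + c / n
  fraction-< a c m@(suc x) n@(suc y) a*n<c*m = toℚᵘ-cancel-<
    (ℚᵘ.<-respˡ-≃ (ℚᵘ.≃-sym (/≃mkℚᵘ (+ a) x)) (ℚᵘ.<-respʳ-≃ (ℚᵘ.≃-sym (/≃mkℚᵘ (+ c) y))
      (*<* (subst₂ ℤ._<_ (ℤ.pos-* a n) (ℤ.pos-* c m) (ℤ.+<+ a*n<c*m)))))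

  numerator≡ : ∀ a M m → a ℕ.* M ℕ.≤ m → ℤ.∣ + a ℤ.* + M ℤ.+ (ℤ.- (+ 1)) ℤ.* + m ∣ ≡ m ℕ.∸ a ℕ.* M
  numerator≡ a M m a*M≤m = begin
    ℤ.∣ + a ℤ.* + M ℤ.+ (ℤ.- (+ 1)) ℤ.* + m ∣
      ≡⟨ cong₂ (λ u v → ℤ.∣ u ℤ.+ v ∣) (sym (ℤ.pos-* a M)) (sym (ℤ.neg-distribˡ-* (+ 1) (+ m))) ⟩
    ℤ.∣ + (a ℕ.* M) ℤ.+ ℤ.- (+ 1 ℤ.* + m) ∣   ≡⟨ cong (λ u → ℤ.∣ + (a ℕ.* M) ℤ.+ ℤ.- u ∣) (ℤ.*-identityˡ (+ m)) ⟩
    ℤ.∣ + (a ℕ.* M) ℤ.+ ℤ.- (+ m) ∣           ≡⟨ cong ℤ.∣_∣ (ℤ.m-n≡m⊖n (a ℕ.* M) m) ⟩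
    ℤ.∣ (a ℕ.* M) ℤ.⊖ m ∣                     ≡⟨ ℤ.∣m⊖n∣≡∣n⊖m∣ (a ℕ.* M) m ⟩
    ℤ.∣ m ℤ.⊖ (a ℕ.* M) ∣                     ≡⟨ cong ℤ.∣_∣ (ℤ.⊖-≥ a*M≤m) ⟩
    m ℕ.∸ a ℕ.* M                              ∎
    where open ≡-Reasoning

  distance< : ∀ a m M .{{_ : NonZero m}} .{{_ : NonZero M}} n d′ .(cop : Coprime (suc n) (suc d′)) →
    a ℕ.* M ℕ.≤ m → (m ℕ.∸ a ℕ.* M) ℕ.* suc d′ ℕ.< m → ∣ + a / m - + 1 / M ∣ < mkℚ +[1+ n ] d′ cop
  distance< a m@(suc x) M@(suc M₀) n d′ cop a*M≤m deficit<m =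
    toℚᵘ-cancel-< (ℚᵘ.<-respˡ-≃ (ℚᵘ.≃-sym distance≃) (*<* cross))
    where
    distance≃ : toℚᵘ ∣ + a / m - + 1 / M ∣ ≃ ℚᵘ.∣ mkℚᵘ (+ a) x ℚᵘ.+ ℚᵘ.- mkℚᵘ (+ 1) M₀ ∣
    distance≃ = ℚᵘ.≃-trans (toℚᵘ-homo-∣-∣ (+ a / m - + 1 / M)) (ℚᵘ.∣-∣-cong
      (ℚᵘ.≃-trans (toℚᵘ-homo-+ (+ a / m) (- (+ 1 / M)))
        (ℚᵘ.+-cong (/≃mkℚᵘ (+ a) x) (ℚᵘ.≃-trans (toℚᵘ-homo‿- (+ 1 / M)) (ℚᵘ.-‿cong (/≃mkℚᵘ (+ 1) M₀))))))
    deficit<ε : (m ℕ.∸ a ℕ.* M) ℕ.* suc d′ ℕ.< suc n ℕ.* (m ℕ.* M)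
    deficit<ε = ℕ.<-≤-trans deficit<m (ℕ.≤-trans (ℕ.m≤m*n m M) (ℕ.m≤n*m (m ℕ.* M) (suc n)))
    numerator : ℕ
    numerator = ℤ.∣ + a ℤ.* + M ℤ.+ (ℤ.- (+ 1)) ℤ.* + m ∣
    cross : + numerator ℤ.* + suc d′ ℤ.< + suc n ℤ.* + (m ℕ.* M)
    cross = subst₂ ℤ._<_
      (trans (cong (λ u → + (u ℕ.* suc d′)) (sym (numerator≡ a M m a*M≤m))) (ℤ.pos-* numerator (suc d′)))
      (ℤ.pos-* (suc n) (m ℕ.* M)) (ℤ.+<+ deficit<ε)

module RatioLimit (b : ℕ) (2≤b : 2 ≤ b) (Z : ℕ → ℕ) (isZ : ∀ m → IsTrailingZeros b m (Z m)) where
  open import Data.Nat as ℕ using (ℕ; _*_; NonZero; >-nonZero; >-nonZero⁻¹; z<s; s≤s; z≤n)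
  import Data.Nat.Properties as ℕ
  open import Data.Integer using (+_; +[1+_]; +0; -[1+_])
  import Data.Integer.Properties as ℤ
  open import Data.Rational using (ℚ; _<_; _/_; _-_; ∣_∣; mkℚ; *<*)
  open import Data.Product using (_,_)
  open import Relation.Binary.PropositionalEquality using (refl; sym; subst; subst₂)
  open import Relation.Nullary using (contradiction)
  open FactorialDivisibility.TrailingZeros b 2≤b Z isZ
  open Fractions

  instance
    b≢0 : NonZero b
    b≢0 = >-nonZero (ℕ.<-trans z<s 2≤b)
    M≢0 : NonZero M
    M≢0 = >-nonZero 1≤M

  limit : ℚ
  limit = + 1 / M

  ratio-increases : ∀ n .{{_ : NonZero n}} → ratio Z n < ratio Z (b * n)
  ratio-increases n = subst₂ _<_ (sym (ratio≡ Z n)) (sym (ratio≡ Z (b * n)))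
    (fraction-< (Z n) (Z (b * n)) n (b * n) (Z-ratio-grows n))
    where
    instance
      b*n≢0 : NonZero (b * n)
      b*n≢0 = ℕ.m*n≢0 b n

  ratio-below-limit : ∀ m .{{_ : NonZero m}} → ratio Z m < limit
  ratio-below-limit m = subst (_< limit) (sym (ratio≡ Z m))
    (fraction-< (Z m) 1 m M (subst (Z m * M ℕ.<_) (sym (ℕ.*-identityˡ m)) (Z*M<m m (>-nonZero⁻¹ m))))

  ratio-converges : ConvergesTo (ratio Z) limit
  ratio-converges (mkℚ +[1+ n ] d′ cop) _ with deficit-small (suc d′)
  ... | N , deficit<m/D = suc N , close
    where
    close : ∀ m → suc N ≤ m → ∣ ratio Z m - limit ∣ < mkℚ +[1+ n ] d′ cop
    close m@(suc _) (s≤s N≤m-1) =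
      distance< (Z m) m M n d′ cop (ℕ.<⇒≤ (Z*M<m m (s≤s z≤n))) (deficit<m/D m (ℕ.m≤n⇒m≤1+n N≤m-1))
  ratio-converges (mkℚ +0 _ _) (*<* 0<0) = contradiction 0<0 (ℤ.<-irrefl refl)
  ratio-converges (mkℚ -[1+ _ ] _ _) (*<* ())

open import Data.Nat.Properties using (m^n≢0)
open import Data.Rational using (ℚ; _<_)
open import Data.Product using (_×_; Σ; _,_)

proposition5 : (b : ℕ) → 2 ≤ b → (Z : ℕ → ℕ) → (∀ m → IsTrailingZeros b m (Z m)) →
    (∀ k → 1 ≤ k → ratio Z (b ^ k) < ratio Z (b ^ suc k))
    × Σ ℚ (λ L → ConvergesTo (ratio Z) L × (∀ k → 1 ≤ k → ratio Z (b ^ k) < L))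
proposition5 b 2≤b Z isZ =
  (λ k _ → ratio-increases (b ^ k) {{m^n≢0 b k}}) ,
  limit , ratio-converges , (λ k _ → ratio-below-limit (b ^ k) {{m^n≢0 b k}})
  where
  open RatioLimit b 2≤b Z isZ
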